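{- Let a 3SAT instance be given with clauses $c_1,\dots,c_s$ and variables $\theta_1,\dots,\theta_t$. Construct a graph $G$ as follows. For each variable $\theta_i$, take a cycle $H_i$ of length $4s$ with vertices $v_{i,1},\dots,v_{i,4s}$ in cyclic order (edges $v_{i,j}v_{i,j+1}$ for $1\le j<4s$ and $v_{i,4s}v_{i,1}$), and set $X_i=\{v_{i,j}: j \text{ even}\}$ and $S_i=\{v_{i,j}: j\equiv 2 \pmod 4\}$. For each clause $c_k$, take a single edge $w_kz_k$ on two new vertices. All these pieces are vertex-disjoint. Then add edges: whenever the variable $\theta_i$ appears positively in clause $c_k$, add the edge $w_kv_{i,4k-3}$, and whenever $\theta_i$ appears negatively in $c_k$, add the edge $w_kv_{i,4k-1}$. Let $X=\bigcup_i X_i\cup\{w_1,\dots,w_s\}$, $Y=V(G)\setminus X$ (so $G$ is an $(X,Y)$-bigraph), and $S=\bigcup_i S_i\cup\{w_1,\dots,w_s\}$. Then $G$ has an $S$-pair if and only if the given 3SAT instance is satisfiable.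
   Context: A matching is a set of pairwise disjoint edges; it saturates a vertex set $T$ if every vertex of $T$ lies in some edge of the matching. For an $(X,Y)$-bigraph $G$ (bipartite graph with partite sets $X,Y$) and $S\subseteq X$, an $S$-pair is a pair $(M_1,M_2)$ of matchings in $G$ with $M_1\cap M_2=\emptyset$, $M_1$ saturating $X$, and $M_2$ saturating $S$. A 3SAT instance is a conjunction of clauses, each a disjunction of at most three literals (variables or their negations); it is satisfiable if some truth assignment makes every clause true. -}

module Defs where

open import Data.Nat using (ℕ; zero; suc; _+_; _*_; _≤_; _%_)
open import Data.Fin using (Fin; toℕ)
open import Data.Bool using (Bool; true; false)
open import Data.List using (List; length)
open import Data.List.Membership.Propositional using (_∈_)
open import Data.List.Relation.Unary.Any using (Any)
open import Data.Product using (Σ; ∃; _×_; _,_)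
open import Data.Empty using (⊥)
open import Relation.Binary.PropositionalEquality using (_≡_)

-- 3SAT instances with s clauses and t variables.
-- A literal (i , true) is θ_i, a literal (i , false) is ¬θ_i
-- (variables are 0-based: Fin t).

Literal : ℕ → Set
Literal t = Fin t × Bool

Clause : ℕ → Set
Clause t = List (Literal t)

Instance : ℕ → ℕ → Set
Instance s t = Fin s → Clause t

Is3SAT : ∀ {s t} → Instance s t → Set
Is3SAT {s} cl = ∀ (k : Fin s) → length (cl k) ≤ 3

LitTrue : ∀ {t} → (Fin t → Bool) → Literal t → Set
LitTrue α (i , b) = α i ≡ b

Satisfiable : ∀ {s t} → Instance s t → Set
Satisfiable {s} {t} cl =
  Σ (Fin t → Bool) λ α → ∀ (k : Fin s) → Any (LitTrue α) (cl k)

-- The graph G.  Indices are 0-based: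
--   cyc i j  is  v_{i, j+1}   (i : Fin t, j : Fin (4 s)),
--   w k, z k are w_{k+1}, z_{k+1}  (k : Fin s).

data V (s t : ℕ) : Set where
  cyc : Fin t → Fin (4 * s) → V s t
  w   : Fin s → V s t
  z   : Fin s → V s t

data Adj {s t : ℕ} (cl : Instance s t) : V s t → V s t → Set where
  cyc-step : ∀ i (j j′ : Fin (4 * s)) → suc (toℕ j) ≡ toℕ j′ →
             Adj cl (cyc i j) (cyc i j′)
  cyc-wrap : ∀ i (j j′ : Fin (4 * s)) → suc (toℕ j) ≡ 4 * s → toℕ j′ ≡ 0 →
             Adj cl (cyc i j) (cyc i j′)
  wz       : ∀ k → Adj cl (w k) (z k)
  -- θ_i positive in c_k : w_k v_{i,4k-3}   (0-based position 4k')
  pos      : ∀ k i (j : Fin (4 * s)) → (i , true) ∈ cl k →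
             toℕ j ≡ 4 * toℕ k → Adj cl (w k) (cyc i j)
  -- θ_i negative in c_k : w_k v_{i,4k-1}   (0-based position 4k'+2)
  neg      : ∀ k i (j : Fin (4 * s)) → (i , false) ∈ cl k →
             toℕ j ≡ 4 * toℕ k + 2 → Adj cl (w k) (cyc i j)
  sym      : ∀ {u v} → Adj cl u v → Adj cl v u

-- X = ⋃ X_i ∪ {w_k} ;  X_i = { v_{i,j} : j even }  (j 1-based ⇔ 0-based index odd)
data InX {s t : ℕ} : V s t → Set where
  xv : ∀ i (j : Fin (4 * s)) → toℕ j % 2 ≡ 1 → InX (cyc i j)
  xw : ∀ k → InX (w k)

-- S = ⋃ S_i ∪ {w_k} ;  S_i = { v_{i,j} : j ≡ 2 mod 4 } (0-based index ≡ 1 mod 4)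
data InS {s t : ℕ} : V s t → Set where
  sv : ∀ i (j : Fin (4 * s)) → toℕ j % 4 ≡ 1 → InS (cyc i j)
  sw : ∀ k → InS (w k)

-- Matchings, represented as symmetric relations (sets of unordered
-- edges) contained in the edge set, in which every vertex has at most
-- one partner (= the edges are pairwise disjoint).

record IsMatching {s t : ℕ} (cl : Instance s t) (M : V s t → V s t → Set) : Set where
  field
    edges    : ∀ {u v} → M u v → Adj cl u v
    symmetric : ∀ {u v} → M u v → M v u
    disjoint : ∀ {u v v′} → M u v → M u v′ → v ≡ v′

Saturates : ∀ {s t} → (V s t → V s t → Set) → (V s t → Set) → Set
Saturates M T = ∀ u → T u → ∃ λ v → M u v

SPair : ∀ {s t} → Instance s t → Set₁
SPair {s} {t} cl =
  Σ (V s t → V s t → Set) λ M₁ →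
  Σ (V s t → V s t → Set) λ M₂ →
    IsMatching cl M₁ × IsMatching cl M₂ ×
    (∀ u v → M₁ u v → M₂ u v → ⊥) ×
    Saturates M₁ InX × Saturates M₂ InS

-- Number the vertices of H_i by the positions 0, …, 4s-1, so that X meets H_i in the odd
-- positions and S in the positions 4k+1, and w_k is joined to position 4k (positive
-- literal) or 4k+2 (negative literal).
-- Given a satisfying assignment α, let M₁ match w_k with z_k and every H_i perfectly,
-- pairing each odd position with its predecessor if α i holds and with its successor
-- otherwise, and let M₂ match the positions 4k+1 along the other perfect matching of H_i.
-- This leaves free the attachment vertex of every true literal, through which M₂
-- matches w_k.
-- Conversely, an odd position is adjacent only to its two cycle neighbours, so M₁
-- matches it forwards or backwards. A forward position followed, two steps later, by a
-- backward one would share its partner with it; going once around H_i, M₁ therefore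
-- matches all odd positions of H_i in one direction, which is the truth value of θ_i.
-- So M₁ saturates H_i perfectly, w_k is M₁-matched to z_k, and M₂ matches w_k to an
-- attachment vertex j. The S-vertex next to j is then M₂-matched away from j, hence
-- M₁-matched towards j, which is exactly the direction that makes the literal true.
module Submission where

open import Defs
open import Data.Bool using (Bool; true; false)
open import Data.Empty using (⊥; ⊥-elim)
open import Data.Fin using (Fin; zero; suc; toℕ; fromℕ; fromℕ<; inject₁)
open import Data.Fin.Properties using (toℕ-injective; toℕ<n; toℕ-fromℕ; toℕ-fromℕ<; toℕ-inject₁)
open import Data.List.Membership.Propositional using (_∈_; find; lose)
open import Data.List.Relation.Unary.Any using (Any)
open import Data.Nat using (ℕ; zero; suc; _+_; _*_; _∸_; _≤_; _<_; _%_; _/_; z≤n; s≤s; s≤s⁻¹; _<?_; NonZero)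
open import Data.Nat.DivMod
  using (m≡m%n+[m/n]*n; m%n%n≡m%n; [m+n]%n≡m%n; [m+kn]%n≡m%n; %-distribˡ-+; m%n<n; /-monoˡ-≤; m∣n⇒o%n%m≡o%m)
open import Data.Nat.Divisibility using (_∣_; divides; ∣-refl; ∣-trans; m∣m*n; n∣m⇒m%n≡0; _∣0)
open import Data.Nat.Properties
  using (suc-injective; +-comm; +-identityʳ; +-cancelˡ-≡; *-cancelˡ-≡; *-suc; *-monoʳ-≤; +-monoˡ-<; ≤-antisym;
         <-≤-trans; <-irrefl; ≮⇒≥; m∸n+n≡m; m∸[m∸n]≡n)
open import Data.Product using (∃; _×_; _,_; proj₁; proj₂)
open import Data.Sum using (_⊎_; inj₁; inj₂)
open import Function.Bundles using (_⇔_; mk⇔)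
open import Relation.Nullary using (¬_; yes; no)
open import Relation.Binary.PropositionalEquality using (_≡_; _≢_; refl; trans; cong; subst)
import Relation.Binary.PropositionalEquality as ≡

next4 : ℕ → ℕ
next4 0 = 1
next4 1 = 2
next4 2 = 3
next4 _ = 0

next4-irrefl : ∀ r → next4 r ≢ r
next4-irrefl 0 ()
next4-irrefl 1 ()
next4-irrefl 2 ()
next4-irrefl (suc (suc (suc r))) ()

next4²-irrefl : ∀ r → next4 (next4 r) ≢ r
next4²-irrefl 0 ()
next4²-irrefl 1 ()
next4²-irrefl 2 ()
next4²-irrefl (suc (suc (suc r))) ()

next4≡1⇒≡0 : ∀ {r} → next4 r ≡ 1 → r ≡ 0
next4≡1⇒≡0 {0} _ = refl
next4≡1⇒≡0 {1} ()
next4≡1⇒≡0 {2} ()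
next4≡1⇒≡0 {suc (suc (suc _))} ()

1∸n≢n : ∀ n → 1 ∸ n ≢ n
1∸n≢n 0 ()
1∸n≢n 1 ()
1∸n≢n (suc (suc n)) ()

1∸n≡1⇒n≡0 : ∀ {n} → 1 ∸ n ≡ 1 → n ≡ 0
1∸n≡1⇒n≡0 {0} _ = refl
1∸n≡1⇒n≡0 {1} ()
1∸n≡1⇒n≡0 {suc (suc _)} ()

[d+n]%d≡n%d : ∀ d n .{{_ : NonZero d}} → (d + n) % d ≡ n % d
[d+n]%d≡n%d d n = trans (cong (_% d) (+-comm d n)) ([m+n]%n≡m%n n d)

%2-suc : ∀ n → suc n % 2 ≡ 1 ∸ n % 2
%2-suc 0 = refl
%2-suc 1 = refl
%2-suc (suc (suc n)) =
  trans ([d+n]%d≡n%d 2 (suc n)) (trans (%2-suc n) (cong (1 ∸_) (≡.sym ([d+n]%d≡n%d 2 n))))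

%2-pred : ∀ n → n % 2 ≡ 1 ∸ suc n % 2
%2-pred n = trans (≡.sym (m∸[m∸n]≡n (s≤s⁻¹ (m%n<n n 2)))) (cong (1 ∸_) (≡.sym (%2-suc n)))

%4-suc : ∀ n → suc n % 4 ≡ next4 (n % 4)
%4-suc 0 = refl
%4-suc 1 = refl
%4-suc 2 = refl
%4-suc 3 = refl
%4-suc (suc (suc (suc (suc n)))) =
  trans ([d+n]%d≡n%d 4 (suc n)) (trans (%4-suc n) (cong next4 (≡.sym ([d+n]%d≡n%d 4 n))))

[r+d*k]%m≡r%m : ∀ {m d} r k .{{_ : NonZero m}} → m ∣ d → (r + d * k) % m ≡ r % m
[r+d*k]%m≡r%m {m} {d} r k m∣d = begin
  (r + d * k) % m            ≡⟨ %-distribˡ-+ r (d * k) m ⟩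
  (r % m + (d * k) % m) % m  ≡⟨ cong (λ x → (r % m + x) % m) (n∣m⇒m%n≡0 (d * k) m (∣-trans m∣d (m∣m*n k))) ⟩
  (r % m + 0) % m            ≡⟨ cong (_% m) (+-identityʳ (r % m)) ⟩
  r % m % m                  ≡⟨ m%n%n≡m%n r m ⟩
  r % m                      ∎
  where open ≡.≡-Reasoning

2∣4 : 2 ∣ 4
2∣4 = divides 2 refl

-- The cycle on Fin n

data Next {n : ℕ} : Fin n → Fin n → Set where
  step : ∀ {a b} → suc (toℕ a) ≡ toℕ b → Next a b
  wrap : ∀ {a b} → suc (toℕ a) ≡ n → toℕ b ≡ 0 → Next a b

next-functional : ∀ {n} {a b b′ : Fin n} → Next a b → Next a b′ → b ≡ b′
next-functional (step e) (step e′) = toℕ-injective (trans (≡.sym e) e′)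
next-functional {b = b} (step e) (wrap e′ _) = ⊥-elim (<-irrefl (trans (≡.sym e) e′) (toℕ<n b))
next-functional {b′ = b′} (wrap e _) (step e′) = ⊥-elim (<-irrefl (trans (≡.sym e′) e) (toℕ<n b′))
next-functional (wrap _ e₀) (wrap _ e₀′) = toℕ-injective (trans e₀ (≡.sym e₀′))

next-injective : ∀ {n} {a a′ b : Fin n} → Next a b → Next a′ b → a ≡ a′
next-injective (step e) (step e′) = toℕ-injective (suc-injective (trans e (≡.sym e′)))
next-injective (step e) (wrap _ e₀) with trans e e₀
... | ()
next-injective (wrap _ e₀) (step e) with trans e e₀
... | ()
next-injective (wrap e _) (wrap e′ _) = toℕ-injective (suc-injective (trans e (≡.sym e′)))

next-exists : ∀ {n} (a : Fin n) → ∃ (Next a)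
next-exists {n} a with suc (toℕ a) <? n
... | yes lt = fromℕ< lt , step (≡.sym (toℕ-fromℕ< lt))
next-exists {suc _} a | no ≮ = zero , wrap (≤-antisym (toℕ<n a) (≮⇒≥ ≮)) refl

prev-exists : ∀ {n} (b : Fin n) → ∃ λ a → Next a b
prev-exists {suc m} zero = fromℕ m , wrap (cong suc (toℕ-fromℕ m)) refl
prev-exists (suc b) = inject₁ b , step (cong suc (toℕ-inject₁ b))

prev-step : ∀ {n m} {b : Fin n} → toℕ b ≡ suc m → ∃ λ a → toℕ a ≡ m × Next a b
prev-step {b = suc b} e =
  inject₁ b , trans (toℕ-inject₁ b) (suc-injective e) , step (cong suc (toℕ-inject₁ b))

last-position : ∀ {n} → Fin n → ∃ λ (l : Fin n) → suc (toℕ l) ≡ n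
last-position {suc m} _ = fromℕ m , cong suc (toℕ-fromℕ m)

next-mod : ∀ {n m} .{{_ : NonZero m}} {a b : Fin n} → m ∣ n → Next a b → toℕ b % m ≡ suc (toℕ a) % m
next-mod _ (step e) = cong (_% _) (≡.sym e)
next-mod {n} {m} m∣n (wrap e e₀) = begin
  toℕ _ % m    ≡⟨ cong (_% m) e₀ ⟩
  0 % m        ≡⟨ n∣m⇒m%n≡0 0 m (m ∣0) ⟩
  0            ≡⟨ ≡.sym (n∣m⇒m%n≡0 n m m∣n) ⟩
  n % m        ≡⟨ cong (_% m) (≡.sym e) ⟩
  suc (toℕ _) % m ∎
  where open ≡.≡-Reasoning

next-asym : ∀ {n} {a b : Fin n} → 4 ∣ n → Next a b → Next b a → ⊥
next-asym {n} {a} {b} 4∣n a→b b→a = next4²-irrefl (toℕ a % 4) (≡.sym (begin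
  toℕ a % 4                 ≡⟨ next-mod 4∣n b→a ⟩
  suc (toℕ b) % 4           ≡⟨ %4-suc (toℕ b) ⟩
  next4 (toℕ b % 4)         ≡⟨ cong next4 (trans (next-mod 4∣n a→b) (%4-suc (toℕ a))) ⟩
  next4 (next4 (toℕ a % 4)) ∎))
  where open ≡.≡-Reasoning

data Along {n : ℕ} (P : Fin n → Set) (a b : Fin n) : Set where
  forward  : P a → Next a b → Along P a b
  backward : P b → Next b a → Along P a b

module _ {n : ℕ} {P : Fin n → Set} where

  along-sym : ∀ {a b} → Along P a b → Along P b a
  along-sym (forward p n) = backward p n
  along-sym (backward p n) = forward p n

  along-unique : (∀ {a b} → P a → Next a b → ¬ P b) →
                 ∀ {a b b′} → Along P a b → Along P a b′ → b ≡ b′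
  along-unique _ (forward _ n) (forward _ n′) = next-functional n n′
  along-unique _ (backward _ n) (backward _ n′) = next-injective n n′
  along-unique alt (forward pa _) (backward pb′ n′) = ⊥-elim (alt pb′ n′ pa)
  along-unique alt (backward pb n) (forward pa _) = ⊥-elim (alt pb n pa)

Odd : ∀ {n} → Fin n → Set
Odd a = toℕ a % 2 ≡ 1

odd-half : ∀ {n} {a : Fin n} → Odd a → toℕ a ≡ suc (toℕ a / 2 * 2)
odd-half {a = a} odd = trans (m≡m%n+[m/n]*n (toℕ a) 2) (cong (_+ toℕ a / 2 * 2) odd)

odd-number : ∀ {n} m {a : Fin n} → toℕ a ≡ suc (m * 2) → Odd a
odd-number m e = trans (cong (_% 2) e) ([m+kn]%n≡m%n 1 m 2)

module Positions (s : ℕ) where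

  next-%2 : ∀ {a b : Fin (4 * s)} → Next a b → toℕ b % 2 ≡ 1 ∸ toℕ a % 2
  next-%2 {a} a→b = trans (next-mod (∣-trans 2∣4 (m∣m*n s)) a→b) (%2-suc (toℕ a))

  prev-%2 : ∀ {a b : Fin (4 * s)} → Next a b → toℕ a % 2 ≡ 1 ∸ toℕ b % 2
  prev-%2 {a} a→b = trans (%2-pred (toℕ a)) (cong (1 ∸_) (≡.sym (next-mod (∣-trans 2∣4 (m∣m*n s)) a→b)))

  next-%4 : ∀ {a b : Fin (4 * s)} → Next a b → toℕ b % 4 ≡ next4 (toℕ a % 4)
  next-%4 {a} a→b = trans (next-mod (m∣m*n s) a→b) (%4-suc (toℕ a))

  next-odd : ∀ {a b : Fin (4 * s)} → Next a b → toℕ a % 2 ≡ 0 → Odd b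
  next-odd a→b even = trans (next-%2 a→b) (cong (1 ∸_) even)

  prev-odd : ∀ {a b : Fin (4 * s)} → Next a b → toℕ b % 2 ≡ 0 → Odd a
  prev-odd a→b even = trans (prev-%2 a→b) (cong (1 ∸_) even)

  two-steps-odd : ∀ {a b c : Fin (4 * s)} → Odd a → Next a b → Next b c → Odd c
  two-steps-odd odd a→b b→c = trans (next-%2 b→c) (cong (1 ∸_) (trans (next-%2 a→b) (cong (1 ∸_) odd)))

  block-bound : ∀ {r} (k : Fin s) → r < 4 → r + 4 * toℕ k < 4 * s
  block-bound {r} k r<4 = <-≤-trans (+-monoˡ-< (4 * toℕ k) r<4)
    (subst (_≤ 4 * s) (*-suc 4 (toℕ k)) (*-monoʳ-≤ 4 (toℕ<n k)))

-- attach b + 4k is the paper's v_{i,4k-3} (b = true) or v_{i,4k-1} (b = false), with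
-- clauses and positions counted from 0.
attach : Bool → ℕ
attach true = 0
attach false = 2

attach<4 : ∀ b → attach b < 4
attach<4 true = s≤s z≤n
attach<4 false = s≤s (s≤s (s≤s z≤n))

attach-even : ∀ b k → (attach b + 4 * k) % 2 ≡ 0
attach-even true k = [r+d*k]%m≡r%m 0 k 2∣4
attach-even false k = [r+d*k]%m≡r%m 2 k 2∣4

attach-%4 : ∀ b k → (attach b + 4 * k) % 4 ≡ attach b
attach-%4 true k = [r+d*k]%m≡r%m 0 k (∣-refl {4})
attach-%4 false k = [r+d*k]%m≡r%m 2 k (∣-refl {4})

attach-injective : ∀ b b′ {k k′} → attach b + 4 * k ≡ attach b′ + 4 * k′ → k ≡ k′
attach-injective b b′ {k} {k′} e =
  *-cancelˡ-≡ k k′ 4 (+-cancelˡ-≡ (attach b) (4 * k) (4 * k′) (trans e (cong (_+ 4 * k′) (≡.sym b≡b′))))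
  where
  b≡b′ : attach b ≡ attach b′
  b≡b′ = trans (≡.sym (attach-%4 b k)) (trans (cong (_% 4) e) (attach-%4 b′ k′))

data CycleNeighbour {s t : ℕ} (i : Fin t) (a : Fin (4 * s)) : V s t → Set where
  next : ∀ {b} → Next a b → CycleNeighbour i a (cyc i b)
  prev : ∀ {b} → Next b a → CycleNeighbour i a (cyc i b)

data ClauseNeighbour {s t : ℕ} (cl : Instance s t) (k : Fin s) : V s t → Set where
  partner : ClauseNeighbour cl k (z k)
  literal : ∀ {i j} b → (i , b) ∈ cl k → toℕ j ≡ attach b + 4 * toℕ k → ClauseNeighbour cl k (cyc i j)

module _ {s t : ℕ} {cl : Instance s t} where

  clause-neighbour  : ∀ {k v} → Adj cl (w k) v → ClauseNeighbour cl k v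
  clause-neighbour′ : ∀ {k v} → Adj cl v (w k) → ClauseNeighbour cl k v
  clause-neighbour (wz _) = partner
  clause-neighbour (pos _ _ _ mem e) = literal true mem e
  clause-neighbour (neg _ _ _ mem e) = literal false mem (trans e (+-comm _ 2))
  clause-neighbour (sym e) = clause-neighbour′ e
  clause-neighbour′ (sym e) = clause-neighbour e

  odd-unattached : ∀ {k i} {a : Fin (4 * s)} → Odd a → ClauseNeighbour cl k (cyc i a) → ⊥
  odd-unattached {k} odd (literal b _ e)
    with trans (≡.sym odd) (trans (cong (_% 2) e) (attach-even b (toℕ k)))
  ... | ()

  odd-cycle-neighbour  : ∀ {i a v} → Odd a → Adj cl (cyc i a) v → CycleNeighbour i a v
  odd-cycle-neighbour′ : ∀ {i a v} → Odd a → Adj cl v (cyc i a) → CycleNeighbour i a v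
  odd-cycle-neighbour _ (cyc-step _ _ _ e) = next (step e)
  odd-cycle-neighbour _ (cyc-wrap _ _ _ e e₀) = next (wrap e e₀)
  odd-cycle-neighbour odd (sym e) = odd-cycle-neighbour′ odd e
  odd-cycle-neighbour′ _ (cyc-step _ _ _ e) = prev (step e)
  odd-cycle-neighbour′ _ (cyc-wrap _ _ _ e e₀) = prev (wrap e e₀)
  odd-cycle-neighbour′ odd e@(pos _ _ _ _ _) = ⊥-elim (odd-unattached odd (clause-neighbour e))
  odd-cycle-neighbour′ odd e@(neg _ _ _ _ _) = ⊥-elim (odd-unattached odd (clause-neighbour e))
  odd-cycle-neighbour′ odd (sym e) = odd-cycle-neighbour odd e

  next-adj : ∀ {i} {a b : Fin (4 * s)} → Next a b → Adj cl (cyc i a) (cyc i b)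
  next-adj (step e) = cyc-step _ _ _ e
  next-adj (wrap e e₀) = cyc-wrap _ _ _ e e₀

  along-adj : ∀ {P i} {a b : Fin (4 * s)} → Along P a b → Adj cl (cyc i a) (cyc i b)
  along-adj (forward _ n) = next-adj n
  along-adj (backward _ n) = sym (next-adj n)

  literal-adj : ∀ {k i b} {j : Fin (4 * s)} → (i , b) ∈ cl k → toℕ j ≡ attach b + 4 * toℕ k →
                Adj cl (w k) (cyc i j)
  literal-adj {b = true} mem e = pos _ _ _ mem e
  literal-adj {b = false} mem e = neg _ _ _ mem (trans e (+-comm 2 _))

-- From an S-pair to a satisfying assignment

MatchedForward MatchedBackward : ∀ {s t} → (V s t → V s t → Set) → Fin t → Fin (4 * s) → Set
MatchedForward M i a = ∃ λ b → Next a b × M (cyc i a) (cyc i b)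
MatchedBackward M i a = ∃ λ b → Next b a × M (cyc i a) (cyc i b)

module _ {s t : ℕ} {M M′ : V s t → V s t → Set} (disjoint : ∀ u v → M u v → M′ u v → ⊥) where

  forward-exclusive : ∀ {i a} → MatchedForward M i a → MatchedForward M′ i a → ⊥
  forward-exclusive (_ , a→b , m) (_ , a→b′ , m′) with next-functional a→b a→b′
  ... | refl = disjoint _ _ m m′

  backward-exclusive : ∀ {i a} → MatchedBackward M i a → MatchedBackward M′ i a → ⊥
  backward-exclusive (_ , b→a , m) (_ , b′→a , m′) with next-injective b→a b′→a
  ... | refl = disjoint _ _ m m′

module MatchingOnCycles {s t : ℕ} {cl : Instance s t} {M : V s t → V s t → Set}
                        (isM : IsMatching cl M) where

  open IsMatching isM

  partner-unique : ∀ {u u′ v} → M u v → M u′ v → u ≡ u′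
  partner-unique m m′ = disjoint (symmetric m) (symmetric m′)

  matched-along : ∀ {i a v} → Odd a → M (cyc i a) v → MatchedForward M i a ⊎ MatchedBackward M i a
  matched-along odd m = along (odd-cycle-neighbour odd (edges m)) m
    where
    along : ∀ {i a v} → CycleNeighbour i a v → M (cyc i a) v → MatchedForward M i a ⊎ MatchedBackward M i a
    along (next a→b) m = inj₁ (_ , a→b , m)
    along (prev b→a) m = inj₂ (_ , b→a , m)

  not-both : ∀ {i a} → MatchedForward M i a → MatchedBackward M i a → ⊥
  not-both (_ , a→b , m) (_ , b′→a , m′) with disjoint m m′
  ... | refl = next-asym (m∣m*n s) a→b b′→a

  forward-after-taken : ∀ {i j q k v} → M (cyc i j) (w k) → Next j q → Odd q → M (cyc i q) v →
                MatchedForward M i q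
  forward-after-taken j∼w j→q odd m with matched-along odd m
  ... | inj₁ f = f
  ... | inj₂ (b , b→q , m′) with next-injective b→q j→q
  ... | refl with disjoint j∼w (symmetric m′)
  ... | ()

  backward-before-taken : ∀ {i j q k v} → M (cyc i j) (w k) → Next q j → Odd q → M (cyc i q) v →
                 MatchedBackward M i q
  backward-before-taken j∼w q→j odd m with matched-along odd m
  ... | inj₂ b = b
  ... | inj₁ (b , q→b , m′) with next-functional q→b q→j
  ... | refl with disjoint j∼w (symmetric m′)
  ... | ()

module PerfectOnCycles {s t : ℕ} {cl : Instance s t} {M : V s t → V s t → Set}
                       (isM : IsMatching cl M) (saturates : Saturates M InX) where

  open IsMatching isM
  open MatchingOnCycles isM
  open Positions s

  matched : ∀ {i a} → Odd a → MatchedForward M i a ⊎ MatchedBackward M i a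
  matched {i} {a} odd = matched-along odd (proj₂ (saturates (cyc i a) (xv i a odd)))

  forward-two-steps : ∀ {i} {a b c : Fin (4 * s)} → Odd a → Next a b → Next b c →
                      MatchedForward M i a → MatchedForward M i c
  forward-two-steps odd a→b b→c (_ , a→b′ , m) with next-functional a→b a→b′
  ... | refl with matched (two-steps-odd odd a→b b→c)
  ... | inj₁ f = f
  ... | inj₂ (_ , b″→c , m′) with next-injective b″→c b→c
  ... | refl with partner-unique m m′
  ... | refl = ⊥-elim (next-asym (m∣m*n s) a→b b→c)

  -- The odd positions are 1, 3, 5, …; ForwardAt i m concerns the m-th one and holds
  -- vacuously if it lies beyond the cycle.
  ForwardAt : Fin t → ℕ → Set
  ForwardAt i m = ∀ {a} → toℕ a ≡ suc (m * 2) → MatchedForward M i a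

  forward-at-suc : ∀ {i} m → ForwardAt i m → ForwardAt i (suc m)
  forward-at-suc m fw c≡ with prev-step c≡
  ... | b , b≡ , b→c with prev-step b≡
  ... | a , a≡ , a→b = forward-two-steps (odd-number m a≡) a→b b→c (fw a≡)

  forward-at-+ : ∀ {i} m d → ForwardAt i m → ForwardAt i (d + m)
  forward-at-+ m zero fw = fw
  forward-at-+ m (suc d) fw = forward-at-suc (d + m) (forward-at-+ m d fw)

  forward-at-≤ : ∀ {i m m′} → m ≤ m′ → ForwardAt i m → ForwardAt i m′
  forward-at-≤ {i} {m} {m′} m≤m′ fw = subst (ForwardAt i) (m∸n+n≡m m≤m′) (forward-at-+ m (m′ ∸ m) fw)

  forward-at-half : ∀ {i a} → Odd a → MatchedForward M i a → ForwardAt i (toℕ a / 2)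
  forward-at-half {i} odd fa a′≡ =
    subst (MatchedForward M i) (toℕ-injective (trans (odd-half odd) (≡.sym a′≡))) fa

  forward-at-wrap : ∀ {i} {l : Fin (4 * s)} → suc (toℕ l) ≡ 4 * s →
                    ForwardAt i (toℕ l / 2) → ForwardAt i 0
  forward-at-wrap l-last fw c≡ with prev-step c≡
  ... | b , b≡0 , b→c = forward-two-steps l-odd l→b b→c (fw (odd-half l-odd))
    where
    l→b = wrap l-last b≡0
    l-odd = prev-odd l→b (cong (_% 2) b≡0)

  forward-everywhere : ∀ {i} {a c : Fin (4 * s)} → Odd a → Odd c →
                       MatchedForward M i a → MatchedForward M i c
  forward-everywhere {a = a} {c} a-odd c-odd fa with last-position a
  ... | l , l-last = forward-at-≤ {m′ = toℕ c / 2} z≤n at-0 (odd-half c-odd)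
    where
    a≤l : toℕ a / 2 ≤ toℕ l / 2
    a≤l = /-monoˡ-≤ 2 (s≤s⁻¹ (subst (toℕ a <_) (≡.sym l-last) (toℕ<n a)))
    at-0 : ForwardAt _ 0
    at-0 = forward-at-wrap l-last (forward-at-≤ a≤l (forward-at-half a-odd fa))

  even-matched-on-cycle : ∀ {i} {j : Fin (4 * s)} → toℕ j % 2 ≡ 0 → ∃ λ b → M (cyc i j) (cyc i b)
  even-matched-on-cycle {j = j} even with next-exists j
  ... | q , j→q with matched (next-odd j→q even)
  ... | inj₂ (b , b→q , m) with next-injective b→q j→q
  ... | refl = q , symmetric m
  even-matched-on-cycle {j = j} even | q , j→q | inj₁ fq with prev-exists j
  ... | p , p→j with forward-everywhere (next-odd j→q even) (prev-odd p→j even) fq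
  ... | b , p→b , m with next-functional p→b p→j
  ... | refl = p , symmetric m

module FromSPair {s t : ℕ} (cl : Instance s t) (M₁ M₂ : V s t → V s t → Set)
                 (isM₁ : IsMatching cl M₁) (isM₂ : IsMatching cl M₂)
                 (disjoint : ∀ u v → M₁ u v → M₂ u v → ⊥)
                 (saturates₁ : Saturates M₁ InX) (saturates₂ : Saturates M₂ InS)
                 (ref : Fin (4 * s)) (ref-odd : Odd ref) where

  open PerfectOnCycles isM₁ saturates₁
  module M₁ = IsMatching isM₁
  module M₂ = IsMatching isM₂
  open MatchingOnCycles isM₁ using (not-both)
  open MatchingOnCycles isM₂ using (forward-after-taken; backward-before-taken)

  polarity : ∀ {i} → MatchedForward M₁ i ref ⊎ MatchedBackward M₁ i ref → Bool
  polarity (inj₁ _) = false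
  polarity (inj₂ _) = true

  α : Fin t → Bool
  α i = polarity (matched {i} ref-odd)

  α-backward : ∀ {i a} → Odd a → MatchedBackward M₁ i a → α i ≡ true
  α-backward {i} odd ba = at-ref (matched ref-odd)
    where
    at-ref : (x : MatchedForward M₁ i ref ⊎ MatchedBackward M₁ i ref) → polarity x ≡ true
    at-ref (inj₁ f) = ⊥-elim (not-both (forward-everywhere ref-odd odd f) ba)
    at-ref (inj₂ _) = refl

  α-forward : ∀ {i a} → Odd a → MatchedForward M₁ i a → α i ≡ false
  α-forward {i} odd fa = at-ref (matched ref-odd)
    where
    at-ref : (x : MatchedForward M₁ i ref ⊎ MatchedBackward M₁ i ref) → polarity x ≡ false
    at-ref (inj₁ _) = refl
    at-ref (inj₂ b) = ⊥-elim (not-both (forward-everywhere odd ref-odd fa) b)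

  α-from-M₂-forward : ∀ {i q} → Odd q → MatchedForward M₂ i q → α i ≡ true
  α-from-M₂-forward odd f₂ with matched odd
  ... | inj₁ f₁ = ⊥-elim (forward-exclusive disjoint f₁ f₂)
  ... | inj₂ b₁ = α-backward odd b₁

  α-from-M₂-backward : ∀ {i q} → Odd q → MatchedBackward M₂ i q → α i ≡ false
  α-from-M₂-backward odd b₂ with matched odd
  ... | inj₁ f₁ = α-forward odd f₁
  ... | inj₂ b₁ = ⊥-elim (backward-exclusive disjoint b₁ b₂)

  w-matched-to-z : ∀ k → M₁ (w k) (z k)
  w-matched-to-z k with saturates₁ (w k) (xw k)
  ... | v , m = from (clause-neighbour (M₁.edges m)) m
    where
    from : ∀ {v} → ClauseNeighbour cl k v → M₁ (w k) v → M₁ (w k) (z k)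
    from partner m = m
    from (literal b _ j≡) m with even-matched-on-cycle (trans (cong (_% 2) j≡) (attach-even b (toℕ k)))
    ... | _ , m′ with M₁.disjoint (M₁.symmetric m) m′
    ... | ()

  literal-polarity : ∀ {k i j} b → toℕ j ≡ attach b + 4 * toℕ k → M₂ (w k) (cyc i j) → α i ≡ b
  literal-polarity {k} {i} {j} true j≡ m with next-exists j
  ... | q , j→q = α-from-M₂-forward q-odd (forward-after-taken (M₂.symmetric m) j→q q-odd q-matched)
    where
    q%m : ∀ {m} .{{_ : NonZero m}} → m ∣ 4 → toℕ q % m ≡ 1 % m
    q%m m∣4 = trans (next-mod (∣-trans m∣4 (m∣m*n s)) j→q)
                    (trans (cong (λ x → suc x % _) j≡) ([r+d*k]%m≡r%m 1 (toℕ k) m∣4))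
    q-odd : Odd q
    q-odd = q%m 2∣4
    q%4 : toℕ q % 4 ≡ 1
    q%4 = q%m (∣-refl {4})
    q-matched = proj₂ (saturates₂ (cyc i q) (sv i q q%4))
  literal-polarity {k} {i} {j} false j≡ m with prev-step j≡
  ... | p , p≡ , p→j = α-from-M₂-backward p-odd (backward-before-taken (M₂.symmetric m) p→j p-odd p-matched)
    where
    p-odd : Odd p
    p-odd = trans (cong (_% 2) p≡) ([r+d*k]%m≡r%m 1 (toℕ k) 2∣4)
    p%4 : toℕ p % 4 ≡ 1
    p%4 = trans (cong (_% 4) p≡) ([r+d*k]%m≡r%m 1 (toℕ k) (∣-refl {4}))
    p-matched = proj₂ (saturates₂ (cyc i p) (sv i p p%4))

  clause-satisfied : ∀ k → Any (LitTrue α) (cl k)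
  clause-satisfied k with saturates₂ (w k) (sw k)
  ... | v , m = from (clause-neighbour (M₂.edges m)) m
    where
    from : ∀ {v} → ClauseNeighbour cl k v → M₂ (w k) v → Any (LitTrue α) (cl k)
    from partner m = ⊥-elim (disjoint _ _ (w-matched-to-z k) m)
    from (literal b mem j≡) m = lose mem (literal-polarity b j≡ m)

  satisfiable : Satisfiable cl
  satisfiable = α , clause-satisfied

SPair⇒satisfiable : ∀ {s t} {cl : Instance s t} → SPair cl → Satisfiable cl
SPair⇒satisfiable {zero} _ = (λ _ → true) , λ ()
SPair⇒satisfiable {suc s} {cl = cl} (M₁ , M₂ , isM₁ , isM₂ , disjoint , saturates₁ , saturates₂)
  with next-exists {4 * suc s} zero
... | ref , 0→ref = FromSPair.satisfiable cl M₁ M₂ isM₁ isM₂ disjoint saturates₁ saturates₂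
                      ref (Positions.next-odd (suc s) 0→ref refl)

-- From a satisfying assignment to an S-pair

-- If α i holds, the M₂-edges {4k+1, 4k+2} leave the positive attachment 4k free;
-- otherwise the M₂-edges {4k, 4k+1} leave the negative attachment 4k+2 free.
start₁ start₂ : Bool → ℕ
start₁ true = 0
start₁ false = 1
start₂ true = 1
start₂ false = 0

module ToSPair {s t : ℕ} (cl : Instance s t) (α : Fin t → Bool)
               (satisfied : ∀ k → Any (LitTrue α) (cl k)) where

  open Positions s

  chosen : Fin s → Literal t
  chosen k = proj₁ (find (satisfied k))

  chosen-∈ : ∀ k → chosen k ∈ cl k
  chosen-∈ k = proj₁ (proj₂ (find (satisfied k)))

  chosen-true : ∀ k → α (proj₁ (chosen k)) ≡ proj₂ (chosen k)
  chosen-true k = proj₂ (proj₂ (find (satisfied k)))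

  Starts₁ Starts₂ : Bool → Fin (4 * s) → Set
  Starts₁ β a = toℕ a % 2 ≡ start₁ β
  Starts₂ β a = toℕ a % 4 ≡ start₂ β

  Attaches : Fin s → Fin t → Fin (4 * s) → Set
  Attaches k i j = proj₁ (chosen k) ≡ i × toℕ j ≡ attach (proj₂ (chosen k)) + 4 * toℕ k

  data M₁ : V s t → V s t → Set where
    cycle   : ∀ {i a b} → Along (Starts₁ (α i)) a b → M₁ (cyc i a) (cyc i b)
    clause  : ∀ {k} → M₁ (w k) (z k)
    clause′ : ∀ {k} → M₁ (z k) (w k)

  data M₂ : V s t → V s t → Set where
    cycle   : ∀ {i a b} → Along (Starts₂ (α i)) a b → M₂ (cyc i a) (cyc i b)
    clause  : ∀ {k i j} → Attaches k i j → M₂ (w k) (cyc i j)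
    clause′ : ∀ {k i j} → Attaches k i j → M₂ (cyc i j) (w k)

  starts₁-alternates : ∀ {β a b} → Starts₁ β a → Next a b → ¬ Starts₁ β b
  starts₁-alternates {β} a-start a→b b-start =
    1∸n≢n (start₁ β) (trans (cong (1 ∸_) (≡.sym a-start)) (trans (≡.sym (next-%2 a→b)) b-start))

  starts₂-alternates : ∀ {β a b} → Starts₂ β a → Next a b → ¬ Starts₂ β b
  starts₂-alternates {β} a-start a→b b-start =
    next4-irrefl (start₂ β) (trans (cong next4 (≡.sym a-start)) (trans (≡.sym (next-%4 a→b)) b-start))

  attachment-uncovered : ∀ {β k} {j b : Fin (4 * s)} → toℕ j ≡ attach β + 4 * k →
                         ¬ Along (Starts₂ β) j b
  attachment-uncovered {β} {k} j≡ (forward j-start _)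
    with trans (≡.sym j-start) (trans (cong (_% 4) j≡) (attach-%4 β k))
  attachment-uncovered {true} _ _ | ()
  attachment-uncovered {false} _ _ | ()
  attachment-uncovered {β} {k} j≡ (backward b-start b→j)
    with trans (≡.sym (trans (next-%4 b→j) (cong next4 b-start))) (trans (cong (_% 4) j≡) (attach-%4 β k))
  attachment-uncovered {true} _ _ | ()
  attachment-uncovered {false} _ _ | ()

  M₁-matching : IsMatching cl M₁
  M₁-matching = record { edges = edges ; symmetric = symmetric ; disjoint = disjoint }
    where
    edges : ∀ {u v} → M₁ u v → Adj cl u v
    edges (cycle e) = along-adj e
    edges clause = wz _
    edges clause′ = sym (wz _)

    symmetric : ∀ {u v} → M₁ u v → M₁ v u
    symmetric (cycle e) = cycle (along-sym e)
    symmetric clause = clause′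
    symmetric clause′ = clause

    disjoint : ∀ {u v v′} → M₁ u v → M₁ u v′ → v ≡ v′
    disjoint (cycle e) (cycle e′) = cong (cyc _) (along-unique starts₁-alternates e e′)
    disjoint clause clause = refl
    disjoint clause′ clause′ = refl

  M₂-matching : IsMatching cl M₂
  M₂-matching = record { edges = edges ; symmetric = symmetric ; disjoint = disjoint }
    where
    edges : ∀ {u v} → M₂ u v → Adj cl u v
    edges (cycle e) = along-adj e
    edges {w k} (clause (refl , j≡)) = literal-adj (chosen-∈ k) j≡
    edges {v = w k} (clause′ (refl , j≡)) = sym (literal-adj (chosen-∈ k) j≡)

    symmetric : ∀ {u v} → M₂ u v → M₂ v u
    symmetric (cycle e) = cycle (along-sym e)
    symmetric (clause a) = clause′ a
    symmetric (clause′ a) = clause a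

    uncovered : ∀ {k i} {j b : Fin (4 * s)} → Attaches k i j → ¬ Along (Starts₂ (α i)) j b
    uncovered {k} (refl , j≡) =
      attachment-uncovered {k = toℕ k} (subst (λ β → _ ≡ attach β + 4 * toℕ k) (≡.sym (chosen-true k)) j≡)

    disjoint : ∀ {u v v′} → M₂ u v → M₂ u v′ → v ≡ v′
    disjoint (cycle e) (cycle e′) = cong (cyc _) (along-unique starts₂-alternates e e′)
    disjoint (cycle e) (clause′ a) = ⊥-elim (uncovered a e)
    disjoint (clause′ a) (cycle e) = ⊥-elim (uncovered a e)
    disjoint {v = w k} {w k′} (clause′ (_ , j≡)) (clause′ (_ , j≡′)) =
      cong w (toℕ-injective (attach-injective (proj₂ (chosen k)) (proj₂ (chosen k′)) (trans (≡.sym j≡) j≡′)))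
    disjoint (clause (refl , j≡)) (clause (refl , j≡′)) = cong (cyc _) (toℕ-injective (trans j≡ (≡.sym j≡′)))

  M₁-M₂-disjoint : ∀ u v → M₁ u v → M₂ u v → ⊥
  M₁-M₂-disjoint _ _ (cycle e₁) (cycle e₂) = apart _ e₁ e₂
    where
    differ : ∀ β {a : Fin (4 * s)} → Starts₁ β a → ¬ Starts₂ β a
    differ β {a} a-start₁ a-start₂
      with trans (≡.sym a-start₁) (trans (≡.sym (m∣n⇒o%n%m≡o%m 2 4 (toℕ a) 2∣4)) (cong (_% 2) a-start₂))
    differ true _ _ | ()
    differ false _ _ | ()
    apart : ∀ β {a b : Fin (4 * s)} → Along (Starts₁ β) a b → ¬ Along (Starts₂ β) a b
    apart β {a} (forward a-start₁ _) (forward a-start₂ _) = differ β {a} a-start₁ a-start₂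
    apart β {b = b} (backward b-start₁ _) (backward b-start₂ _) = differ β {b} b-start₁ b-start₂
    apart β (forward _ a→b) (backward _ b→a) = next-asym (m∣m*n s) a→b b→a
    apart β (backward _ b→a) (forward _ a→b) = next-asym (m∣m*n s) a→b b→a

  M₁-saturates : Saturates M₁ InX
  M₁-saturates (cyc i a) (xv _ _ odd) = let b , e = along-from (α i) in cyc i b , cycle e
    where
    along-from : ∀ β → ∃ (Along (Starts₁ β) a)
    along-from false = let b , a→b = next-exists a in b , forward odd a→b
    along-from true = let b , b→a = prev-exists a in
      b , backward (1∸n≡1⇒n≡0 (trans (≡.sym (next-%2 b→a)) odd)) b→a
  M₁-saturates (w k) (xw _) = z k , clause

  M₂-saturates : Saturates M₂ InS
  M₂-saturates (cyc i a) (sv _ _ a%4) = let b , e = along-from (α i) in cyc i b , cycle e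
    where
    along-from : ∀ β → ∃ (Along (Starts₂ β) a)
    along-from true = let b , a→b = next-exists a in b , forward a%4 a→b
    along-from false = let b , b→a = prev-exists a in
      b , backward (next4≡1⇒≡0 (trans (≡.sym (next-%4 b→a)) a%4)) b→a
  M₂-saturates (w k) (sw _) = cyc _ j , clause (refl , toℕ-fromℕ< j<4s)
    where
    j<4s = block-bound k (attach<4 (proj₂ (chosen k)))
    j = fromℕ< j<4s

  spair : SPair cl
  spair = M₁ , M₂ , M₁-matching , M₂-matching , M₁-M₂-disjoint , M₁-saturates , M₂-saturates

mainTheorem2 : (s t : ℕ) (cl : Instance s t) → Is3SAT cl →
    SPair cl ⇔ Satisfiable cl
mainTheorem2 s t cl _ = mk⇔ SPair⇒satisfiable (λ (α , satisfied) → ToSPair.spair cl α satisfied)
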